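{- Let $(X,\le,c)$ be a strongly involution poset and write $x^c=c(x)$. Let $A$ be a boolean partial map on $X$. If $A$ is a +WBPM, then: (i) if $w$ is a minimal element of $A^{ -1}(P)$ with $w^c\in\mathrm{dom}(A)$ and $A(w^c)=N$, then $w^c$ is a maximal element of $A^{ -1}(N)$; (ii) if $x,x^c\in\mathrm{dom}(A)$ and $x^c\le x$, then $A(x)=P$. If $A$ is a −WBPM, then: (i') if $w$ is a maximal element of $A^{ -1}(N)$ with $w^c\in\mathrm{dom}(A)$ and $A(w^c)=P$, then $w^c$ is a minimal element of $A^{ -1}(P)$; (ii') if $x,x^c\in\mathrm{dom}(A)$ and $x^c\le x$, then $A(x^c)=N$.
   Context: A strongly involution poset is a poset $(X,\le)$ with $c:X\to X$ such that $c(c(x))=x$, $x\le y\Rightarrow c(y)\le c(x)$, and $c(x)\ne x$ for all $x$ (when $|X|\ge2$). $\mathbf{2}$ is the chain $N<P$. A boolean partial map (BPM) on $X$ is a map $A:\mathrm{dom}(A)\to\mathbf{2}$ with $\mathrm{dom}(A)\subseteq X$. For $Z\subseteq X$, $Z^c=\{z^c:z\in Z\}$. $A$ is up-positive if $A^{ -1}(P)$ is an up-set of $X$ (i.e. $z\in A^{ -1}(P)$, $z\le x$ imply $x\in A^{ -1}(P)$), down-negative if $A^{ -1}(N)$ is a down-set of $X$, complemented positive if $A^{ -1}(N)^c\subseteq A^{ -1}(P)$, complemented negative if $A^{ -1}(P)^c\subseteq A^{ -1}(N)$. A +WBPM is a BPM that is up-positive, down-negative and complemented positive; a −WBPM is one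 that is up-positive, down-negative and complemented negative. -}

module Defs where

open import Level using (Level; _⊔_; suc)
open import Data.Maybe using (Maybe; just; nothing)
open import Data.Product using (Σ; _×_; _,_)
open import Data.Nat using (ℕ; _≥_)
open import Relation.Nullary using (¬_)
open import Relation.Binary.PropositionalEquality using (_≡_; _≢_)
open import Relation.Binary.Structures using (IsPartialOrder)

data Two : Set where
  N P : Two

data _≤₂_ : Two → Two → Set where
  N≤N : N ≤₂ N
  N≤P : N ≤₂ P
  P≤P : P ≤₂ P

-- The condition c x ≢ x is required only when
-- X has at least two elements: "|X| ≥ 2" is expressed as the existence
-- of two distinct points.
record SIPoset (a ℓ : Level) : Set (suc (a ⊔ ℓ)) where
  field
    Carrier        : Set a
    _≤_            : Carrier → Carrier → Set ℓ
    isPartialOrder : IsPartialOrder _≡_ _≤_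
    c              : Carrier → Carrier
    c-invol        : ∀ x → c (c x) ≡ x
    c-antitone     : ∀ {x y} → x ≤ y → c y ≤ c x
    c-nofix        : (Σ Carrier λ u → Σ Carrier λ v → u ≢ v) → ∀ x → c x ≢ x

module _ {a ℓ : Level} (X : SIPoset a ℓ) where
  open SIPoset X

  -- A boolean partial map: dom(A) = { x | A x ≢ nothing },
  -- and A(x) = b  iff  A x ≡ just b.
  BPM : Set a
  BPM = Carrier → Maybe Two

  _⁻¹_∋_ : BPM → Two → Carrier → Set
  A ⁻¹ b ∋ x = A x ≡ just b

  InDom : BPM → Carrier → Set
  InDom A x = Σ Two λ b → A x ≡ just b

  UpPositive : BPM → Set (a ⊔ ℓ)
  UpPositive A = ∀ {z x} → A ⁻¹ P ∋ z → z ≤ x → A ⁻¹ P ∋ x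

  DownNegative : BPM → Set (a ⊔ ℓ)
  DownNegative A = ∀ {z x} → A ⁻¹ N ∋ z → x ≤ z → A ⁻¹ N ∋ x

  ComplementedPositive : BPM → Set a
  ComplementedPositive A = ∀ {z} → A ⁻¹ N ∋ z → A ⁻¹ P ∋ c z

  ComplementedNegative : BPM → Set a
  ComplementedNegative A = ∀ {z} → A ⁻¹ P ∋ z → A ⁻¹ N ∋ c z

  IsPlusWBPM : BPM → Set (a ⊔ ℓ)
  IsPlusWBPM A = UpPositive A × DownNegative A × ComplementedPositive A

  IsMinusWBPM : BPM → Set (a ⊔ ℓ)
  IsMinusWBPM A = UpPositive A × DownNegative A × ComplementedNegative A

  IsMinimalIn : (Carrier → Set) → Carrier → Set (a ⊔ ℓ)
  IsMinimalIn S w = S w × (∀ {y} → S y → y ≤ w → y ≡ w)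

  IsMaximalIn : (Carrier → Set) → Carrier → Set (a ⊔ ℓ)
  IsMaximalIn S w = S w × (∀ {y} → S y → w ≤ y → y ≡ w)

module Submission where

-- Complementation is an order-reversing bijection, so it carries minimal
-- elements of A⁻¹(P) to maximal elements of any set it maps into A⁻¹(P),
-- such as A⁻¹(N) for a +WBPM (and dually for a −WBPM).  For (ii), if
-- A x = N then A (xᶜ) = P, and xᶜ ≤ x forces A x = P by up-positivity.

open import Defs
open import Level using (Level)
open import Data.Maybe using (just)
open import Data.Product using (_×_; _,_)
open import Relation.Binary.PropositionalEquality using (_≡_; sym; trans; subst; cong)

module _ {a ℓ : Level} (X : SIPoset a ℓ) where
  open SIPoset X

  c-injective : ∀ {x y} → c x ≡ c y → x ≡ y
  c-injective {x} {y} cx≡cy = trans (sym (c-invol x)) (trans (cong c cx≡cy) (c-invol y))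

  c-swapˡ : ∀ {x y} → c x ≤ y → c y ≤ x
  c-swapˡ {x} cx≤y = subst (_ ≤_) (c-invol x) (c-antitone cx≤y)

  c-swapʳ : ∀ {x y} → x ≤ c y → y ≤ c x
  c-swapʳ {y = y} x≤cy = subst (_≤ _) (c-invol y) (c-antitone x≤cy)

  c-minimal⇒maximal : ∀ {S T : Carrier → Set} {w} → (∀ {y} → T y → S (c y)) →
                      IsMinimalIn X S w → T (c w) → IsMaximalIn X T (c w)
  c-minimal⇒maximal T⇒cS (_ , w-min) Tcw =
    Tcw , λ Ty cw≤y → c-injective (trans (w-min (T⇒cS Ty) (c-swapˡ cw≤y)) (sym (c-invol _)))

  c-maximal⇒minimal : ∀ {S T : Carrier → Set} {w} → (∀ {y} → T y → S (c y)) →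
                      IsMaximalIn X S w → T (c w) → IsMinimalIn X T (c w)
  c-maximal⇒minimal T⇒cS (_ , w-max) Tcw =
    Tcw , λ Ty y≤cw → c-injective (trans (w-max (T⇒cS Ty) (c-swapʳ y≤cw)) (sym (c-invol _)))

  module _ {A : BPM X} where

    positive-above-complement : UpPositive X A → ComplementedPositive X A →
                                ∀ x → InDom X A x → c x ≤ x → A x ≡ just P
    positive-above-complement up cp x (P , Ax≡P) cx≤x = Ax≡P
    positive-above-complement up cp x (N , Ax≡N) cx≤x =
      subst (λ z → A z ≡ just P) (c-invol x) (up (cp Ax≡N) (subst (c x ≤_) (sym (c-invol x)) cx≤x))

    negative-below-complement : DownNegative X A → ComplementedNegative X A →
                                ∀ x → InDom X A (c x) → c x ≤ x → A (c x) ≡ just N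
    negative-below-complement down cn x (N , Acx≡N) cx≤x = Acx≡N
    negative-below-complement down cn x (P , Acx≡P) cx≤x =
      down (subst (λ z → A z ≡ just N) (c-invol x) (cn Acx≡P)) cx≤x

proposition2p13 : {a ℓ : Level} (X : SIPoset a ℓ) (A : BPM X) →
    let open SIPoset X in
    (IsPlusWBPM X A →
      (∀ w → IsMinimalIn X (λ x → A x ≡ just P) w → A (c w) ≡ just N →
         IsMaximalIn X (λ x → A x ≡ just N) (c w))
      × (∀ x → InDom X A x → InDom X A (c x) → c x ≤ x → A x ≡ just P))
    × (IsMinusWBPM X A →
      (∀ w → IsMaximalIn X (λ x → A x ≡ just N) w → A (c w) ≡ just P →
         IsMinimalIn X (λ x → A x ≡ just P) (c w))
      × (∀ x → InDom X A x → InDom X A (c x) → c x ≤ x → A (c x) ≡ just N))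
proposition2p13 X A =
  (λ { (up , _ , cp) →
         (λ _ → c-minimal⇒maximal X cp)
       , (λ x x∈dom _ → positive-above-complement X up cp x x∈dom) })
  ,
  (λ { (_ , down , cn) →
         (λ _ → c-maximal⇒minimal X cn)
       , (λ x _ cx∈dom → negative-below-complement X down cn x cx∈dom) })
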